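{- For all integers $k\ge 3$ and $1\le c\le 5$, a tight $\mathrm{CDCCD}\big(c(4k-6)+1,\,k,\,c^2(4k-6)+c\big)$ exists.
   Context: A circular double change covering design $\mathrm{CDCCD}(v,k,b)$ (strength 2) is a $v$-set $V$ with an ordered list $(B_1,\dots,B_b)$ of $k$-subsets of $V$ (blocks) such that every 2-subset of $V$ lies in at least one block, $|B_i\setminus B_{i+1}|=|B_{i+1}\setminus B_i|=2$ for $1\le i<b$, and $|B_b\setminus B_1|=|B_1\setminus B_b|=2$. Let $g_2(v,k)=\lceil\binom v2/(2k-3)\rceil$. A CDCCD is economical if $b=g_2(v,k)$, and tight if it is economical and $\binom v2/(2k-3)$ is an integer. -}

module Defs where

open import Data.Nat using (ℕ; zero; suc; _+_; _*_; _∸_; _/_)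
open import Data.Nat.Combinatorics using (_C_)
open import Data.Nat.Divisibility using (_∣_)
open import Data.Fin using (Fin; toℕ)
open import Data.Fin.Subset using (Subset; _∈_; _─_; ∣_∣)
open import Data.Product using (Σ; _×_)
open import Data.Sum using (_⊎_)
open import Relation.Binary.PropositionalEquality using (_≡_; _≢_)

-- ceiling division ⌈ n / d ⌉ (with ⌈ n / 0 ⌉ := 0, never used for d = 2k-3 ≥ 3)
ceilDiv : ℕ → ℕ → ℕ
ceilDiv n zero    = 0
ceilDiv n (suc d) = (n + d) / suc d

g₂ : ℕ → ℕ → ℕ
g₂ v k = ceilDiv (v C 2) (2 * k ∸ 3)

DoubleChange : {v : ℕ} → Subset v → Subset v → Set
DoubleChange A B = (∣ A ─ B ∣ ≡ 2) × (∣ B ─ A ∣ ≡ 2)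

CyclicNext : (b : ℕ) → Fin b → Fin b → Set
CyclicNext b i j = (toℕ j ≡ suc (toℕ i)) ⊎ ((suc (toℕ i) ≡ b) × (toℕ j ≡ 0))

record CDCCD (v k b : ℕ) : Set where
  field
    block     : Fin b → Subset v
    blockSize : ∀ i → ∣ block i ∣ ≡ k
    covering  : ∀ (x y : Fin v) → x ≢ y → Σ (Fin b) (λ i → (x ∈ block i) × (y ∈ block i))
    change    : ∀ (i j : Fin b) → CyclicNext b i j → DoubleChange (block i) (block j)

Economical : (v k b : ℕ) → Set
Economical v k b = b ≡ g₂ v k

Tight : (v k b : ℕ) → Set
Tight v k b = Economical v k b × ((2 * k ∸ 3) ∣ (v C 2))

TightCDCCDExists : (v k b : ℕ) → Set
TightCDCCDExists v k b = CDCCD v k b × Tight v k b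

-- Work in ℤ_V with V = c(4k − 6) + 1 and write k = m + 3.  Every block is a translate of one of
-- c base blocks B_t = {0, …, m} ∪ {a_t, b_t}, where the run {0, …, m} is common to all of them.
-- Round r of the cyclic order lists B_0 − r, …, B_{c−1} − r; inside a round only the pair
-- {a_t, b_t} is exchanged, and since b_0 = m + 1 the step from B_{c−1} − r to B_0 − (r + 1)
-- slides the run by one and again changes exactly two points.  The V·c blocks cover every pair
-- as soon as each difference 1, …, (V − 1)/2 occurs inside a base block; the differences between
-- the run and a point p fill the interval [p − m, p].  For c ≤ 5 the points a_t, b_t are affine in m
-- and all requirements are linear inequalities between them, verified coefficientwise.  Finally
-- V·c·(2k − 3) = C(V, 2), so the design is tight.
module Submission where

open import Data.Bool.Base using (Bool; true; false; _∧_; _∨_; not; T)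
open import Data.Bool.Properties using (T-∧; T-∨; T-≡)
open import Data.Empty using (⊥; ⊥-elim)
open import Data.Fin.Base as Fin using (Fin; toℕ; fromℕ<)
open import Data.Fin.Properties using (toℕ-injective; toℕ<n; toℕ-fromℕ<)
open import Data.Fin.Subset using (Subset; _─_; ∣_∣; _∈_)
open import Data.List.Base using (List; []; _∷_; length)
open import Data.Nat.Base
open import Data.Nat.Combinatorics using (_C_; nC1≡n; nCk+nC[k+1]≡[n+1]C[k+1])
open import Data.Nat.DivMod
open import Data.Nat.Divisibility using (divides)
open import Data.Nat.Properties
open import Algebra.Properties.CommutativeSemigroup +-commutativeSemigroup using (x∙yz≈y∙xz)
open import Data.Nat.Tactic.RingSolver using (solve-∀)
open import Data.Product using (Σ; _×_; _,_; proj₁; proj₂)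
open import Data.Sum using (_⊎_; inj₁; inj₂; [_,_]; map)
open import Data.Unit.Base using (tt)
open import Data.Vec.Base using (tabulate; _∷_)
open import Data.Vec.Properties using (lookup∘tabulate; lookup⇒[]=)
open import Function.Base using (_∘_; id)
open import Function.Bundles using (_⇔_; Equivalence; mk⇔)
open import Relation.Binary.PropositionalEquality hiding ([_])
open import Relation.Nullary using (¬_; yes; no)

open import Defs

open Equivalence using (to; from)

bit : Bool → ℕ
bit true  = 1
bit false = 0

count : ℕ → (ℕ → Bool) → ℕ
count zero    h = 0
count (suc n) h = bit (h 0) + count n (h ∘ suc)

count-cong : ∀ n {h g} → (∀ x → x < n → h x ≡ g x) → count n h ≡ count n g
count-cong zero    h≗g = refl
count-cong (suc n) h≗g =
  cong₂ (λ b k → bit b + k) (h≗g 0 z<s) (count-cong n (λ x x<n → h≗g (suc x) (s<s x<n)))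

count-suc : ∀ n h → count (suc n) h ≡ count n h + bit (h n)
count-suc zero    h = +-comm (bit (h 0)) 0
count-suc (suc n) h =
  trans (cong (bit (h 0) +_) (count-suc n (h ∘ suc)))
        (sym (+-assoc (bit (h 0)) (count n (h ∘ suc)) (bit (h (suc n)))))

count-false : ∀ n → count n (λ _ → false) ≡ 0
count-false zero    = refl
count-false (suc n) = count-false n

count-<ᵇ : ∀ n {l} → l ≤ n → count n (_<ᵇ l) ≡ l
count-<ᵇ n       {zero}  _         = count-false n
count-<ᵇ (suc n) {suc l} (s≤s l≤n) = cong suc (count-<ᵇ n l≤n)

count-≡ᵇ : ∀ n {p} → p < n → count n (_≡ᵇ p) ≡ 1
count-≡ᵇ (suc n) {zero}  _         = cong suc (count-false n)
count-≡ᵇ (suc n) {suc p} (s<s p<n) = count-≡ᵇ n p<n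

count-∨ : ∀ n f g → (∀ x → T (f x) → T (g x) → ⊥) →
          count n (λ x → f x ∨ g x) ≡ count n f + count n g
count-∨ zero    f g disjoint = refl
count-∨ (suc n) f g disjoint with f 0 | g 0 | disjoint 0 | count-∨ n (f ∘ suc) (g ∘ suc) (disjoint ∘ suc)
... | true  | true  | d₀ | _  = ⊥-elim (d₀ tt tt)
... | true  | false | _  | ih = cong suc ih
... | false | true  | _  | ih = trans (cong suc ih) (sym (+-suc _ _))
... | false | false | _  | ih = ih

T-≡ᵇ : ∀ {x y} → x ≡ y → T (x ≡ᵇ y)
T-≡ᵇ {x} refl = ≡⇒≡ᵇ x x refl

T-⇔⇒≡ : ∀ {x y} → (T x → T y) → (T y → T x) → x ≡ y
T-⇔⇒≡ {true}  {true}  _ _ = refl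
T-⇔⇒≡ {true}  {false} f _ = ⊥-elim (f tt)
T-⇔⇒≡ {false} {true}  _ g = ⊥-elim (g tt)
T-⇔⇒≡ {false} {false} _ _ = refl

count-≡ᵇ-pair : ∀ n {p q} → p ≢ q → p < n → q < n → count n (λ x → (x ≡ᵇ p) ∨ (x ≡ᵇ q)) ≡ 2
count-≡ᵇ-pair n {p} {q} p≢q p<n q<n = begin
    count n (λ x → (x ≡ᵇ p) ∨ (x ≡ᵇ q))  ≡⟨ count-∨ n _ _ disjoint ⟩
    count n (_≡ᵇ p) + count n (_≡ᵇ q)    ≡⟨ cong₂ _+_ (count-≡ᵇ n p<n) (count-≡ᵇ n q<n) ⟩
    2                                    ∎
  where
  open ≡-Reasoning
  disjoint : ∀ x → T (x ≡ᵇ p) → T (x ≡ᵇ q) → ⊥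
  disjoint x x≡p x≡q = p≢q (trans (sym (≡ᵇ⇒≡ x p x≡p)) (≡ᵇ⇒≡ x q x≡q))

count-pair : ∀ n h {p q} → p ≢ q → p < n → q < n →
             (∀ x → x < n → T (h x) → x ≡ p ⊎ x ≡ q) → T (h p) → T (h q) → count n h ≡ 2
count-pair n h {p} {q} p≢q p<n q<n only-p-q hp hq = trans (count-cong n h≗p∨q) (count-≡ᵇ-pair n p≢q p<n q<n)
  where
  h≗p∨q : ∀ x → x < n → h x ≡ ((x ≡ᵇ p) ∨ (x ≡ᵇ q))
  h≗p∨q x x<n = T-⇔⇒≡
    (λ hx → from (T-∨ {x ≡ᵇ p}) (map T-≡ᵇ T-≡ᵇ (only-p-q x x<n hx)))
    (λ x≡p∨q → [ (λ e → subst (T ∘ h) (sym (≡ᵇ⇒≡ x p e)) hp)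
               , (λ e → subst (T ∘ h) (sym (≡ᵇ⇒≡ x q e)) hq) ] (to T-∨ x≡p∨q))

_∖ᵇ_ : {A : Set} → (A → Bool) → (A → Bool) → A → Bool
(f ∖ᵇ g) x = f x ∧ not (g x)

∖ᵇ⇔ : ∀ {A : Set} (f g : A → Bool) x → T ((f ∖ᵇ g) x) ⇔ (T (f x) × ¬ T (g x))
∖ᵇ⇔ f g x with f x | g x
... | true  | true  = mk⇔ (λ ()) (λ (_ , ¬gx) → ¬gx tt)
... | true  | false = mk⇔ (λ _ → tt , λ ()) (λ _ → tt)
... | false | _     = mk⇔ (λ ()) proj₁

count-∖ᵇ-pair : ∀ n f g {p q} → p ≢ q → p < n → q < n →
                (∀ x → x < n → T (f x) → ¬ T (g x) → x ≡ p ⊎ x ≡ q) →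
                T (f p) → ¬ T (g p) → T (f q) → ¬ T (g q) → count n (f ∖ᵇ g) ≡ 2
count-∖ᵇ-pair n f g p≢q p<n q<n only-p-q fp ¬gp fq ¬gq =
  count-pair n (f ∖ᵇ g) p≢q p<n q<n
    (λ x x<n x∈ → let fx , ¬gx = to (∖ᵇ⇔ f g x) x∈ in only-p-q x x<n fx ¬gx)
    (from (∖ᵇ⇔ f g _) (fp , ¬gp)) (from (∖ᵇ⇔ f g _) (fq , ¬gq))

%-absorbˡ : ∀ x y n .{{_ : NonZero n}} → (x % n + y) % n ≡ (x + y) % n
%-absorbˡ x y n = begin
    (x % n + y) % n          ≡⟨ %-distribˡ-+ (x % n) y n ⟩
    (x % n % n + y % n) % n  ≡⟨ cong (λ z → (z + y % n) % n) (m%n%n≡m%n x n) ⟩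
    (x % n + y % n) % n      ≡⟨ %-distribˡ-+ x y n ⟨
    (x + y) % n              ∎
  where open ≡-Reasoning

%-absorbʳ : ∀ x y n .{{_ : NonZero n}} → (x + y % n) % n ≡ (x + y) % n
%-absorbʳ x y n = begin
    (x + y % n) % n  ≡⟨ cong (_% n) (+-comm x _) ⟩
    (y % n + x) % n  ≡⟨ %-absorbˡ y x n ⟩
    (y + x) % n      ≡⟨ cong (_% n) (+-comm y x) ⟩
    (x + y) % n      ∎
  where open ≡-Reasoning

count-rotate₁ : ∀ n h .{{_ : NonZero n}} → count n (λ x → h (suc x % n)) ≡ count n h
count-rotate₁ (suc n) h = begin
    count (suc n) (λ x → h (suc x % suc n))
  ≡⟨ count-suc n _ ⟩
    count n (λ x → h (suc x % suc n)) + bit (h (suc n % suc n))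
  ≡⟨ cong₂ _+_ (count-cong n (λ x x<n → cong h (m<n⇒m%n≡m (s<s x<n))))
               (cong (bit ∘ h) (n%n≡0 (suc n))) ⟩
    count n (h ∘ suc) + bit (h 0)
  ≡⟨ +-comm (count n (h ∘ suc)) _ ⟩
    count (suc n) h
  ∎
  where open ≡-Reasoning

count-rotate : ∀ n r h .{{_ : NonZero n}} → count n (λ x → h ((x + r) % n)) ≡ count n h
count-rotate n zero    h = count-cong n (λ x x<n → cong h (trans (cong (_% n) (+-identityʳ x)) (m<n⇒m%n≡m x<n)))
count-rotate n (suc r) h = begin
    count n (λ x → h ((x + suc r) % n))
  ≡⟨ count-cong n (λ x _ → cong h (begin
       (x + suc r) % n      ≡⟨ cong (_% n) (+-suc x r) ⟩
       (suc x + r) % n      ≡⟨ %-absorbˡ (suc x) r n ⟨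
       (suc x % n + r) % n  ∎)) ⟩
    count n (λ x → h ((suc x % n + r) % n))
  ≡⟨ count-rotate₁ n (λ y → h ((y + r) % n)) ⟩
    count n (λ y → h ((y + r) % n))
  ≡⟨ count-rotate n r h ⟩
    count n h
  ∎
  where open ≡-Reasoning

∣tabulate∣ : ∀ n h → ∣ tabulate {n = n} (h ∘ toℕ) ∣ ≡ count n h
∣tabulate∣ zero    h = refl
∣tabulate∣ (suc n) h with h 0
... | true  = cong suc (∣tabulate∣ n (h ∘ suc))
... | false = ∣tabulate∣ n (h ∘ suc)

tabulate-─ : ∀ n (f g : Fin n → Bool) → tabulate f ─ tabulate g ≡ tabulate (f ∖ᵇ g)
tabulate-─ zero    f g = refl
tabulate-─ (suc n) f g with f Fin.zero | g Fin.zero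
... | true  | true  = cong (false ∷_) (tabulate-─ n (f ∘ Fin.suc) (g ∘ Fin.suc))
... | true  | false = cong (true ∷_) (tabulate-─ n (f ∘ Fin.suc) (g ∘ Fin.suc))
... | false | true  = cong (false ∷_) (tabulate-─ n (f ∘ Fin.suc) (g ∘ Fin.suc))
... | false | false = cong (false ∷_) (tabulate-─ n (f ∘ Fin.suc) (g ∘ Fin.suc))

-- Base blocks B_t = {0, …, m} ∪ {a t, b t} ⊆ ℤ_(vv + 1) for t ≤ cc.
record BaseBlocks (vv m cc : ℕ) : Set where
  field
    a b         : ℕ → ℕ
    m<a         : ∀ t → t ≤ cc → m < a t
    m<b         : ∀ t → t ≤ cc → m < b t
    a≢b         : ∀ t → t ≤ cc → a t ≢ b t
    a≤vv        : ∀ t → t ≤ cc → a t ≤ vv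
    b≤vv        : ∀ t → t ≤ cc → b t ≤ vv
    b₀≡1+m      : b 0 ≡ suc m
    step-apart  : ∀ t → t < cc → a t ≢ a (suc t) × a t ≢ b (suc t) × b t ≢ a (suc t) × b t ≢ b (suc t)
    last-a<vv   : a cc < vv
    last-b<vv   : b cc < vv
    1+last-a≢a₀ : suc (a cc) ≢ a 0
    1+last-b≢a₀ : suc (b cc) ≢ a 0

module Development {vv m cc : ℕ} (B : BaseBlocks vv m cc) where
  open BaseBlocks B

  V L c : ℕ
  V = suc vv
  L = suc m
  c = suc cc

  Member : ℕ → ℕ → Set
  Member t y = y < L ⊎ y ≡ a t ⊎ y ≡ b t

  member? : ℕ → ℕ → Bool
  member? t y = (y <ᵇ L) ∨ ((y ≡ᵇ a t) ∨ (y ≡ᵇ b t))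

  member?⇔ : ∀ t y → T (member? t y) ⇔ Member t y
  member?⇔ t y = mk⇔
    (λ h → map (<ᵇ⇒< y L) (map (≡ᵇ⇒≡ y (a t)) (≡ᵇ⇒≡ y (b t)) ∘ to T-∨) (to T-∨ h))
    (λ h → from (T-∨ {y <ᵇ L}) (map <⇒<ᵇ (from (T-∨ {y ≡ᵇ a t}) ∘ map T-≡ᵇ T-≡ᵇ) h))

  member?⁺ : ∀ t y → Member t y → T (member? t y)
  member?⁺ t y = from (member?⇔ t y)

  member?⁻ : ∀ t y → T (member? t y) → Member t y
  member?⁻ t y = to (member?⇔ t y)

  a∈ : ∀ t → Member t (a t)
  a∈ t = inj₂ (inj₁ refl)

  b∈ : ∀ t → Member t (b t)
  b∈ t = inj₂ (inj₂ refl)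

  ∉-pair : ∀ {t p} → L ≤ p → p ≢ a t → p ≢ b t → ¬ Member t p
  ∉-pair L≤p _   _   (inj₁ p<L)        = <⇒≱ p<L L≤p
  ∉-pair _   p≢a _   (inj₂ (inj₁ p≡a)) = p≢a p≡a
  ∉-pair _   _   p≢b (inj₂ (inj₂ p≡b)) = p≢b p≡b

  a<V : ∀ t → t ≤ cc → a t < V
  a<V t t≤cc = s≤s (a≤vv t t≤cc)

  b<V : ∀ t → t ≤ cc → b t < V
  b<V t t≤cc = s≤s (b≤vv t t≤cc)

  L≤vv : L ≤ vv
  L≤vv = ≤-trans (m<a cc ≤-refl) (<⇒≤ last-a<vv)

  block-size : ∀ t → t ≤ cc → count V (member? t) ≡ suc (suc L)
  block-size t t≤cc = begin
      count V (member? t)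
    ≡⟨ count-∨ V _ _ run∩pair≡∅ ⟩
      count V (_<ᵇ L) + count V (λ y → (y ≡ᵇ a t) ∨ (y ≡ᵇ b t))
    ≡⟨ cong₂ _+_ (count-<ᵇ V (m≤n⇒m≤1+n L≤vv)) (count-≡ᵇ-pair V (a≢b t t≤cc) (a<V t t≤cc) (b<V t t≤cc)) ⟩
      L + 2
    ≡⟨ +-comm L 2 ⟩
      suc (suc L)
    ∎
    where
    open ≡-Reasoning
    run∩pair≡∅ : ∀ y → T (y <ᵇ L) → T ((y ≡ᵇ a t) ∨ (y ≡ᵇ b t)) → ⊥
    run∩pair≡∅ y y<L y∈ab =
      [ (λ y≡a → <⇒≱ (<ᵇ⇒< y L y<L) (subst (L ≤_) (sym y≡a) (m<a t t≤cc)))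
      , (λ y≡b → <⇒≱ (<ᵇ⇒< y L y<L) (subst (L ≤_) (sym y≡b) (m<b t t≤cc))) ]
      (map (≡ᵇ⇒≡ y (a t)) (≡ᵇ⇒≡ y (b t)) (to T-∨ y∈ab))

  leaving-step : ∀ {s t} → s ≤ cc → a s ≢ a t → a s ≢ b t → b s ≢ a t → b s ≢ b t →
                 count V (member? s ∖ᵇ member? t) ≡ 2
  leaving-step {s} {t} s≤cc as≢at as≢bt bs≢at bs≢bt =
    count-∖ᵇ-pair V (member? s) (member? t) (a≢b s s≤cc) (a<V s s≤cc) (b<V s s≤cc)
      (λ y _ y∈s y∉t → [ ⊥-elim ∘ y∉t ∘ member?⁺ t y ∘ inj₁ , id ] (member?⁻ s y y∈s))
      (member?⁺ s _ (a∈ s)) (∉-pair (m<a s s≤cc) as≢at as≢bt ∘ member?⁻ t _)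
      (member?⁺ s _ (b∈ s)) (∉-pair (m<b s s≤cc) bs≢at bs≢bt ∘ member?⁻ t _)

  -- Membership in B₀ − 1: the block after B_cc − r is (B₀ − 1) − r.
  member?₀₋₁ : ℕ → Bool
  member?₀₋₁ y = member? 0 (suc y % V)

  Member₀₋₁ : ℕ → Set
  Member₀₋₁ y = y < L ⊎ y ≡ vv ⊎ suc y ≡ a 0

  member?₀₋₁⇔ : ∀ y → y < V → T (member?₀₋₁ y) ⇔ Member₀₋₁ y
  member?₀₋₁⇔ y y<V with m≤n⇒m<n∨m≡n (s≤s⁻¹ y<V)
  ... | inj₂ refl =
    mk⇔ (λ _ → inj₂ (inj₁ refl)) (λ _ → subst (T ∘ member? 0) (sym (n%n≡0 V)) (member?⁺ 0 0 (inj₁ z<s)))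
  ... | inj₁ y<vv = mk⇔
    (λ h → out (member?⁻ 0 (suc y) (subst (T ∘ member? 0) 1+y%V≡1+y h)))
    (λ h → subst (T ∘ member? 0) (sym 1+y%V≡1+y) (member?⁺ 0 (suc y) (into h)))
    where
    1+y%V≡1+y : suc y % V ≡ suc y
    1+y%V≡1+y = m<n⇒m%n≡m (s<s y<vv)
    out : Member 0 (suc y) → Member₀₋₁ y
    out (inj₁ 1+y<L)         = inj₁ (<-trans (n<1+n y) 1+y<L)
    out (inj₂ (inj₁ 1+y≡a₀)) = inj₂ (inj₂ 1+y≡a₀)
    out (inj₂ (inj₂ 1+y≡b₀)) = inj₁ (≤-reflexive (trans 1+y≡b₀ b₀≡1+m))
    into : Member₀₋₁ y → Member 0 (suc y)
    into (inj₁ y<L) with m≤n⇒m<n∨m≡n y<L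
    ... | inj₁ 1+y<L = inj₁ 1+y<L
    ... | inj₂ 1+y≡L = inj₂ (inj₂ (trans 1+y≡L (sym b₀≡1+m)))
    into (inj₂ (inj₁ refl))   = ⊥-elim (<-irrefl refl y<vv)
    into (inj₂ (inj₂ 1+y≡a₀)) = inj₂ (inj₁ 1+y≡a₀)

  L<a₀ : L < a 0
  L<a₀ = ≤∧≢⇒< (m<a 0 z≤n) (λ L≡a₀ → a≢b 0 z≤n (trans (sym L≡a₀) (sym b₀≡1+m)))

  1+pred-a₀ : suc (pred (a 0)) ≡ a 0
  1+pred-a₀ = suc-pred (a 0) {{>-nonZero (<-trans z<s L<a₀)}}

  pred-a₀<vv : pred (a 0) < vv
  pred-a₀<vv = subst (_≤ vv) (sym 1+pred-a₀) (a≤vv 0 z≤n)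

  leaving-wrap : count V (member? cc ∖ᵇ member?₀₋₁) ≡ 2
  leaving-wrap =
    count-∖ᵇ-pair V (member? cc) member?₀₋₁ (a≢b cc ≤-refl) (a<V cc ≤-refl) (b<V cc ≤-refl)
      (λ y y<V y∈cc y∉₀₋₁ → [ ⊥-elim ∘ y∉₀₋₁ ∘ from (member?₀₋₁⇔ y y<V) ∘ inj₁ , id ] (member?⁻ cc y y∈cc))
      (member?⁺ cc _ (a∈ cc)) (∉₀₋₁ (m<a cc ≤-refl) last-a<vv 1+last-a≢a₀ ∘ to (member?₀₋₁⇔ _ (a<V cc ≤-refl)))
      (member?⁺ cc _ (b∈ cc)) (∉₀₋₁ (m<b cc ≤-refl) last-b<vv 1+last-b≢a₀ ∘ to (member?₀₋₁⇔ _ (b<V cc ≤-refl)))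
    where
    ∉₀₋₁ : ∀ {p} → L ≤ p → p < vv → suc p ≢ a 0 → ¬ Member₀₋₁ p
    ∉₀₋₁ L≤p _    _      (inj₁ p<L)           = <⇒≱ p<L L≤p
    ∉₀₋₁ _   p<vv _      (inj₂ (inj₁ p≡vv))   = <⇒≢ p<vv p≡vv
    ∉₀₋₁ _   _    1+p≢a₀ (inj₂ (inj₂ 1+p≡a₀)) = 1+p≢a₀ 1+p≡a₀

  entering-wrap : count V (member?₀₋₁ ∖ᵇ member? cc) ≡ 2
  entering-wrap =
    count-∖ᵇ-pair V member?₀₋₁ (member? cc) (≢-sym (<⇒≢ pred-a₀<vv)) ≤-refl (m<n⇒m<1+n pred-a₀<vv)
      (λ y y<V y∈₀₋₁ y∉cc → [ ⊥-elim ∘ y∉cc ∘ member?⁺ cc y ∘ inj₁ , map id (cong pred) ]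
                               (to (member?₀₋₁⇔ y y<V) y∈₀₋₁))
      (from (member?₀₋₁⇔ vv ≤-refl) (inj₂ (inj₁ refl)))
      (∉-pair L≤vv (≢-sym (<⇒≢ last-a<vv)) (≢-sym (<⇒≢ last-b<vv)) ∘ member?⁻ cc vv)
      (from (member?₀₋₁⇔ _ (m<n⇒m<1+n pred-a₀<vv)) (inj₂ (inj₂ 1+pred-a₀)))
      (∉-pair (s≤s⁻¹ (subst (L <_) (sym 1+pred-a₀) L<a₀))
              (λ e → 1+last-a≢a₀ (trans (cong suc (sym e)) 1+pred-a₀))
              (λ e → 1+last-b≢a₀ (trans (cong suc (sym e)) 1+pred-a₀)) ∘ member?⁻ cc _)

  rotate : ℕ → (ℕ → Bool) → ℕ → Bool
  rotate r f y = f ((y + r) % V)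

  shifted : ℕ → ℕ → Subset V
  shifted r t = tabulate (rotate r (member? t) ∘ toℕ)

  ∣shifted∣ : ∀ r t → t ≤ cc → ∣ shifted r t ∣ ≡ suc (suc L)
  ∣shifted∣ r t t≤cc =
    trans (∣tabulate∣ V (rotate r (member? t))) (trans (count-rotate V r (member? t)) (block-size t t≤cc))

  ∣shifted─shifted∣ : ∀ r s r′ t → ∣ shifted r s ─ shifted r′ t ∣ ≡
                                    count V (rotate r (member? s) ∖ᵇ rotate r′ (member? t))
  ∣shifted─shifted∣ r s r′ t =
    trans (cong ∣_∣ (tabulate-─ V (rotate r (member? s) ∘ toℕ) (rotate r′ (member? t) ∘ toℕ)))
          (∣tabulate∣ V (rotate r (member? s) ∖ᵇ rotate r′ (member? t)))

  step-change : ∀ r t → t < cc → DoubleChange (shifted r t) (shifted r (suc t))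
  step-change r t t<cc with step-apart t t<cc
  ... | at≢at′ , at≢bt′ , bt≢at′ , bt≢bt′ =
    trans (∣shifted─shifted∣ r t r (suc t))
          (trans (count-rotate V r (member? t ∖ᵇ member? (suc t)))
                 (leaving-step (<⇒≤ t<cc) at≢at′ at≢bt′ bt≢at′ bt≢bt′)) ,
    trans (∣shifted─shifted∣ r (suc t) r t)
          (trans (count-rotate V r (member? (suc t) ∖ᵇ member? t))
                 (leaving-step t<cc (≢-sym at≢at′) (≢-sym bt≢at′)
                                    (≢-sym at≢bt′) (≢-sym bt≢bt′)))

  wrap-change : ∀ r r′ → suc r % V ≡ r′ % V → DoubleChange (shifted r cc) (shifted r′ 0)
  wrap-change r r′ 1+r≡r′ =
    trans (∣shifted─shifted∣ r cc r′ 0)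
          (trans (count-cong V (λ y _ → cong (λ z → rotate r (member? cc) y ∧ not z) (next-round y)))
                 (trans (count-rotate V r (member? cc ∖ᵇ member?₀₋₁)) leaving-wrap)) ,
    trans (∣shifted─shifted∣ r′ 0 r cc)
          (trans (count-cong V (λ y _ → cong (λ z → z ∧ not (rotate r (member? cc) y)) (next-round y)))
                 (trans (count-rotate V r (member?₀₋₁ ∖ᵇ member? cc)) entering-wrap))
    where
    next-round : ∀ y → rotate r′ (member? 0) y ≡ rotate r member?₀₋₁ y
    next-round y = cong (member? 0) (begin
        (y + r′) % V             ≡⟨ %-absorbʳ y r′ V ⟨
        (y + r′ % V) % V         ≡⟨ cong (λ z → (y + z) % V) 1+r≡r′ ⟨
        (y + suc r % V) % V      ≡⟨ %-absorbʳ y (suc r) V ⟩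
        (y + suc r) % V          ≡⟨ cong (_% V) (+-suc y r) ⟩
        suc (y + r) % V          ≡⟨ %-absorbʳ 1 (y + r) V ⟨
        suc ((y + r) % V) % V    ∎)
      where open ≡-Reasoning

  block : Fin (V * c) → Subset V
  block i = shifted (toℕ i / c) (toℕ i % c)

  block-index : ∀ (i : Fin (V * c)) q r → q < c → toℕ i ≡ q + r * c → block i ≡ shifted r q
  block-index i q r q<c i≡q+rc = cong₂ shifted
    (trans (cong (_/ c) i≡q+rc)
           (trans (+-distrib-/ q (r * c) no-carry) (cong₂ _+_ (m<n⇒m/n≡0 q<c) (m*n/n≡m r c))))
    (trans (cong (_% c) i≡q+rc) (trans ([m+kn]%n≡m%n q r c) (m<n⇒m%n≡m q<c)))
    where
    no-carry : q % c + r * c % c < c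
    no-carry = subst (_< c) (sym (trans (cong₂ _+_ (m<n⇒m%n≡m q<c) (m*n%n≡0 r c)) (+-identityʳ q))) q<c

  successor-change : ∀ (i j : Fin (V * c)) q r → q < c → toℕ i ≡ q + r * c → toℕ j ≡ suc (toℕ i) →
                     DoubleChange (block i) (block j)
  successor-change i j q r (s≤s q≤cc) i≡q+rc j≡1+i with m≤n⇒m<n∨m≡n q≤cc
  ... | inj₁ q<cc = subst₂ DoubleChange
    (sym (block-index i q r (s≤s q≤cc) i≡q+rc))
    (sym (block-index j (suc q) r (s≤s q<cc) (trans j≡1+i (cong suc i≡q+rc))))
    (step-change r q q<cc)
  ... | inj₂ refl = subst₂ DoubleChange
    (sym (block-index i q r (s≤s q≤cc) i≡q+rc))
    (sym (block-index j 0 (suc r) z<s (trans j≡1+i (cong suc i≡q+rc))))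
    (wrap-change r (suc r) refl)

  change : ∀ i j → CyclicNext (V * c) i j → DoubleChange (block i) (block j)
  change i j (inj₁ j≡1+i) =
    successor-change i j (toℕ i % c) (toℕ i / c) (m%n<n (toℕ i) c) (m≡m%n+[m/n]*n (toℕ i) c) j≡1+i
  change i j (inj₂ (1+i≡Vc , j≡0)) = subst₂ DoubleChange
    (sym (block-index i cc vv (n<1+n cc) (suc-injective 1+i≡Vc)))
    (sym (block-index j 0 0 z<s j≡0))
    (wrap-change vv 0 (n%n≡0 V))

  record Difference (d : ℕ) : Set where
    constructor difference
    field
      {t u w} : ℕ
      t≤cc    : t ≤ cc
      u∈      : Member t u
      w∈      : Member t w
      u<V     : u < V
      w<V     : w < V
      u+d≡w   : u + d ≡ w ⊎ u + d ≡ w + V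

  sum%V : ∀ {u d w} → w < V → u + d ≡ w ⊎ u + d ≡ w + V → (u + d) % V ≡ w
  sum%V w<V (inj₁ e) = trans (cong (_% V) e) (m<n⇒m%n≡m w<V)
  sum%V {w = w} w<V (inj₂ e) = trans (cong (_% V) e) (trans ([m+n]%n≡m%n w V) (m<n⇒m%n≡m w<V))

  difference-below : ∀ {t p d} → t ≤ cc → Member t p → p < V → d ≤ p → p ≤ d + m → Difference d
  difference-below {p = p} {d} t≤cc p∈ p<V d≤p p≤d+m =
    difference t≤cc (inj₁ (s≤s (subst (p ∸ d ≤_) (m+n∸m≡n d m) (∸-monoˡ-≤ d p≤d+m)))) p∈
      (≤-<-trans (m∸n≤m p d) p<V) p<V (inj₁ (m∸n+n≡m d≤p))

  difference-above : ∀ {t p d} → t ≤ cc → Member t p → p < V → V ≤ d + p → d + p ≤ V + m →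
                     Difference d
  difference-above {p = p} {d} t≤cc p∈ p<V V≤d+p d+p≤V+m =
    difference t≤cc p∈ (inj₁ w<L) p<V (≤-trans w<L (m≤n⇒m≤1+n L≤vv))
      (inj₂ (trans (+-comm p d) (sym (m∸n+n≡m V≤d+p))))
    where
    w<L : d + p ∸ V < L
    w<L = s≤s (subst (d + p ∸ V ≤_) (m+n∸m≡n V m) (∸-monoˡ-≤ V d+p≤V+m))

  difference-reflect : ∀ {d} → d ≤ V → Difference (V ∸ d) → Difference d
  difference-reflect {d} d≤V (difference t≤cc u∈ w∈ u<V w<V u+d≡w) =
    difference t≤cc w∈ u∈ w<V u<V (reflect u+d≡w)
    where
    open ≡-Reasoning
    cancel : ∀ u → u + (V ∸ d) + d ≡ u + V
    cancel u = trans (+-assoc u (V ∸ d) d) (cong (u +_) (m∸n+n≡m d≤V))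
    reflect : ∀ {u w} → u + (V ∸ d) ≡ w ⊎ u + (V ∸ d) ≡ w + V → w + d ≡ u ⊎ w + d ≡ u + V
    reflect {u} {w} (inj₁ e) = inj₂ (trans (cong (_+ d) (sym e)) (cancel u))
    reflect {u} {w} (inj₂ e) = inj₁ (+-cancelʳ-≡ V (w + d) u (begin
      w + d + V       ≡⟨ +-assoc w d V ⟩
      w + (d + V)     ≡⟨ cong (w +_) (+-comm d V) ⟩
      w + (V + d)     ≡⟨ +-assoc w V d ⟨
      w + V + d       ≡⟨ cong (_+ d) e ⟨
      u + (V ∸ d) + d ≡⟨ cancel u ⟩
      u + V           ∎))

  differences-from-half : ∀ N → V ≡ suc (N + N) → (∀ d → 0 < d → d ≤ N → Difference d) →
                          ∀ d → 0 < d → d < V → Difference d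
  differences-from-half N V≡2N+1 half d 0<d d<V with d ≤? N
  ... | yes d≤N = half d 0<d d≤N
  ... | no  d≰N = difference-reflect (<⇒≤ d<V) (half (V ∸ d) (m<n⇒0<n∸m d<V) V∸d≤N)
    where
    V∸d≤N : V ∸ d ≤ N
    V∸d≤N = +-cancelʳ-≤ (suc N) (V ∸ d) N (begin
      V ∸ d + suc N  ≤⟨ +-monoʳ-≤ (V ∸ d) (≰⇒> d≰N) ⟩
      V ∸ d + d      ≡⟨ m∸n+n≡m (<⇒≤ d<V) ⟩
      V              ≡⟨ V≡2N+1 ⟩
      suc (N + N)    ≡⟨ +-suc N N ⟨
      N + suc N      ∎)
      where open ≤-Reasoning

  ∈shifted : ∀ {r t} (x : Fin V) → Member t ((toℕ x + r) % V) → x ∈ shifted r t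
  ∈shifted {r} {t} x x∈ = lookup⇒[]= x (shifted r t)
    (trans (lookup∘tabulate (rotate r (member? t) ∘ toℕ) x) (to T-≡ (member?⁺ t _ x∈)))

  translate-back : ∀ X Z → X ≤ V → (X + (Z + (V ∸ X)) % V) % V ≡ Z % V
  translate-back X Z X≤V = begin
      (X + (Z + (V ∸ X)) % V) % V  ≡⟨ %-absorbʳ X _ V ⟩
      (X + (Z + (V ∸ X))) % V      ≡⟨ cong (_% V) (x∙yz≈y∙xz X Z (V ∸ X)) ⟩
      (Z + (X + (V ∸ X))) % V      ≡⟨ cong (λ n → (Z + n) % V) (m+[n∸m]≡n X≤V) ⟩
      (Z + V) % V                  ≡⟨ [m+n]%n≡m%n Z V ⟩
      Z % V                        ∎
    where open ≡-Reasoning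

  pair-in-block : ∀ (x y : Fin V) {d} → Difference d → (toℕ x + d) % V ≡ toℕ y →
                  Σ (Fin (V * c)) (λ i → (x ∈ block i) × (y ∈ block i))
  pair-in-block x y {d} (difference {t} {u} {w} t≤cc u∈ w∈ u<V w<V u+d≡w) X+d≡Y =
    fromℕ< n<Vc , subst (x ∈_) block≡ (∈shifted x (subst (Member t) (sym X+r≡u) u∈))
                , subst (y ∈_) block≡ (∈shifted y (subst (Member t) (sym Y+r≡w) w∈))
    where
    open ≡-Reasoning
    X = toℕ x
    Y = toℕ y
    r = (u + (V ∸ X)) % V
    n<Vc : t + r * c < V * c
    n<Vc = <-≤-trans (+-monoˡ-< (r * c) (s≤s t≤cc)) (*-monoˡ-≤ c (m%n<n (u + (V ∸ X)) V))
    block≡ : shifted r t ≡ block (fromℕ< n<Vc)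
    block≡ = sym (block-index (fromℕ< n<Vc) t r (s≤s t≤cc) (toℕ-fromℕ< n<Vc))
    X+r≡u : (X + r) % V ≡ u
    X+r≡u = trans (translate-back X u (<⇒≤ (toℕ<n x))) (m<n⇒m%n≡m u<V)
    Y+r≡w : (Y + r) % V ≡ w
    Y+r≡w = begin
      (Y + r) % V             ≡⟨ cong (λ z → (z + r) % V) X+d≡Y ⟨
      ((X + d) % V + r) % V   ≡⟨ %-absorbˡ (X + d) r V ⟩
      (X + d + r) % V         ≡⟨ cong (_% V) (trans (+-assoc X d r) (x∙yz≈y∙xz X d r)) ⟩
      (d + (X + r)) % V       ≡⟨ %-absorbʳ d (X + r) V ⟨
      (d + (X + r) % V) % V   ≡⟨ cong (λ z → (d + z) % V) X+r≡u ⟩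
      (d + u) % V             ≡⟨ cong (_% V) (+-comm d u) ⟩
      (u + d) % V             ≡⟨ sum%V {u} {d} w<V u+d≡w ⟩
      w                       ∎

  covering : (∀ d → 0 < d → d < V → Difference d) →
             ∀ (x y : Fin V) → x ≢ y → Σ (Fin (V * c)) (λ i → (x ∈ block i) × (y ∈ block i))
  covering differences x y x≢y = pair-in-block x y (differences d 0<d (m%n<n (Y + (V ∸ X)) V)) X+d≡Y
    where
    X Y d : ℕ
    X = toℕ x
    Y = toℕ y
    d = (Y + (V ∸ X)) % V
    X+d≡Y : (X + d) % V ≡ Y
    X+d≡Y = trans (translate-back X Y (<⇒≤ (toℕ<n x))) (m<n⇒m%n≡m (toℕ<n y))
    0<d : 0 < d
    0<d = n≢0⇒n>0 (λ d≡0 → x≢y (toℕ-injective (begin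
      X             ≡⟨ m<n⇒m%n≡m (toℕ<n x) ⟨
      X % V         ≡⟨ cong (_% V) (+-identityʳ X) ⟨
      (X + 0) % V   ≡⟨ cong (λ n → (X + n) % V) d≡0 ⟨
      (X + d) % V   ≡⟨ X+d≡Y ⟩
      Y             ∎)))
      where open ≡-Reasoning

  design : (∀ d → 0 < d → d < V → Difference d) → CDCCD V (suc (suc L)) (V * c)
  design differences = record
    { block     = block
    ; blockSize = λ i → ∣shifted∣ (toℕ i / c) (toℕ i % c) (s≤s⁻¹ (m%n<n (toℕ i) c))
    ; covering  = covering differences
    ; change    = change
    }


infix 8 _m+_
record Affine : Set where
  constructor _m+_
  field
    slope intercept : ℕ

⟦_⟧ : Affine → ℕ → ℕ
⟦ α m+ β ⟧ m = α * m + β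

-- Comparisons of affine forms decided coefficientwise: sufficient for the comparison at every m.
infix 4 _≤ᶜ_ _<ᶜ_ _≢ᶜ_
infixl 6 _+ᶜ_ _∸ᶜ_

_≤ᶜ_ : Affine → Affine → Bool
(α m+ β) ≤ᶜ (α′ m+ β′) = (α ≤ᵇ α′) ∧ (β ≤ᵇ β′)

1+ᶜ_ : Affine → Affine
1+ᶜ (α m+ β) = α m+ suc β

_<ᶜ_ : Affine → Affine → Bool
p <ᶜ q = 1+ᶜ p ≤ᶜ q

_≢ᶜ_ : Affine → Affine → Bool
p ≢ᶜ q = (p <ᶜ q) ∨ (q <ᶜ p)

_+ᶜ_ : Affine → Affine → Affine
(α m+ β) +ᶜ (α′ m+ β′) = (α + α′) m+ (β + β′)

_∸ᶜ_ : Affine → Affine → Affine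
(α m+ β) ∸ᶜ (α′ m+ β′) = (α ∸ α′) m+ (β ∸ β′)

module _ (m : ℕ) where

  ≤ᶜ-sound : ∀ p q → T (p ≤ᶜ q) → ⟦ p ⟧ m ≤ ⟦ q ⟧ m
  ≤ᶜ-sound (α m+ β) (α′ m+ β′) p≤q with to T-∧ p≤q
  ... | α≤α′ , β≤β′ = +-mono-≤ (*-monoˡ-≤ m (≤ᵇ⇒≤ α α′ α≤α′)) (≤ᵇ⇒≤ β β′ β≤β′)

  ⟦1+ᶜ⟧ : ∀ p → ⟦ 1+ᶜ p ⟧ m ≡ suc (⟦ p ⟧ m)
  ⟦1+ᶜ⟧ (α m+ β) = +-suc (α * m) β

  <ᶜ-sound : ∀ p q → T (p <ᶜ q) → ⟦ p ⟧ m < ⟦ q ⟧ m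
  <ᶜ-sound p q p<q = subst (_≤ ⟦ q ⟧ m) (⟦1+ᶜ⟧ p) (≤ᶜ-sound (1+ᶜ p) q p<q)

  ≢ᶜ-sound : ∀ p q → T (p ≢ᶜ q) → ⟦ p ⟧ m ≢ ⟦ q ⟧ m
  ≢ᶜ-sound p q p≢q = [ <⇒≢ ∘ <ᶜ-sound p q , ≢-sym ∘ <⇒≢ ∘ <ᶜ-sound q p ] (to T-∨ p≢q)

  ⟦+ᶜ⟧ : ∀ p q → ⟦ p +ᶜ q ⟧ m ≡ ⟦ p ⟧ m + ⟦ q ⟧ m
  ⟦+ᶜ⟧ (α m+ β) (α′ m+ β′) = begin
    (α + α′) * m + (β + β′)      ≡⟨ cong (_+ (β + β′)) (*-distribʳ-+ m α α′) ⟩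
    α * m + α′ * m + (β + β′)    ≡⟨ +-assoc (α * m) (α′ * m) (β + β′) ⟩
    α * m + (α′ * m + (β + β′))  ≡⟨ cong (α * m +_) (x∙yz≈y∙xz (α′ * m) β β′) ⟩
    α * m + (β + (α′ * m + β′))  ≡⟨ +-assoc (α * m) β (α′ * m + β′) ⟨
    α * m + β + (α′ * m + β′)    ∎
    where open ≡-Reasoning

  ⟦∸ᶜ⟧ : ∀ p q → T (q ≤ᶜ p) → ⟦ p ∸ᶜ q ⟧ m + ⟦ q ⟧ m ≡ ⟦ p ⟧ m
  ⟦∸ᶜ⟧ (α m+ β) (α′ m+ β′) q≤p with to T-∧ q≤p
  ... | α′≤α , β′≤β = trans (sym (⟦+ᶜ⟧ ((α ∸ α′) m+ (β ∸ β′)) (α′ m+ β′)))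
    (cong₂ (λ x y → ⟦ x m+ y ⟧ m) (m∸n+n≡m (≤ᵇ⇒≤ α′ α α′≤α)) (m∸n+n≡m (≤ᵇ⇒≤ β′ β β′≤β)))

  ⟦1m+0⟧ : ⟦ 1 m+ 0 ⟧ m ≡ m
  ⟦1m+0⟧ = trans (+-identityʳ (1 * m)) (*-identityˡ m)

  ⟦1m+1⟧ : ⟦ 1 m+ 1 ⟧ m ≡ suc m
  ⟦1m+1⟧ = trans (⟦1+ᶜ⟧ (1 m+ 0)) (cong suc ⟦1m+0⟧)

data Side : Set where
  side-a side-b : Side

other : Side → Side
other side-a = side-b
other side-b = side-a

point : Side → Affine × Affine → Affine
point side-a = proj₁
point side-b = proj₂

-- An item lists the differences modulo V contributed by the point p on the given side of a base
-- block: p − u and u − p for u in the run (from-run, to-run), and q − p for the other point q,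
-- without or with a wrap around V (to-other, to-other-wrapping).
data Kind : Set where
  from-run to-run to-other to-other-wrapping : Kind

record Item : Set where
  constructor item
  field
    kind  : Kind
    block : ℕ
    side  : Side

-- Base block 0 is {0, …, m} ∪ {a₀, m + 1}; pairs lists (a t, b t) for the base blocks t = 1, …, c − 1.
record Construction : Set where
  field
    a₀    : Affine
    pairs : List (Affine × Affine)
    items : List Item

allBelow : ℕ → (ℕ → Bool) → Bool
allBelow zero    f = true
allBelow (suc n) f = allBelow n f ∧ f n

allBelow-sound : ∀ n f → T (allBelow n f) → ∀ t → t < n → T (f t)
allBelow-sound (suc n) f all t t<1+n with to T-∧ all | m≤n⇒m<n∨m≡n (s≤s⁻¹ t<1+n)
... | all<n , _   | inj₁ t<n  = allBelow-sound n f all<n t t<n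
... | _     , f-n | inj₂ refl = f-n

module Checks (K : Construction) where
  open Construction K

  cc c : ℕ
  cc = length pairs
  c  = suc cc

  pairAt : ℕ → Affine × Affine
  pairAt zero    = a₀ , 1 m+ 1
  pairAt (suc t) = lookupOr pairs t
    where
    lookupOr : List (Affine × Affine) → ℕ → Affine × Affine
    lookupOr []       _       = 0 m+ 0 , 0 m+ 0   -- junk, only reached for t > cc
    lookupOr (p ∷ ps) zero    = p
    lookupOr (p ∷ ps) (suc t) = lookupOr ps t

  half vv : Affine
  half = (2 * c) m+ (3 * c)
  vv   = half +ᶜ half

  aᶜ bᶜ : ℕ → Affine
  aᶜ = proj₁ ∘ pairAt
  bᶜ = proj₂ ∘ pairAt

  lo hi : Item → Affine
  lo (item from-run          t s) = point s (pairAt t) ∸ᶜ 1 m+ 0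
  lo (item to-run            t s) = 1+ᶜ (vv ∸ᶜ point s (pairAt t))
  lo (item to-other          t s) = point (other s) (pairAt t) ∸ᶜ point s (pairAt t)
  lo (item to-other-wrapping t s) = point (other s) (pairAt t) +ᶜ 1+ᶜ vv ∸ᶜ point s (pairAt t)
  hi (item from-run          t s) = point s (pairAt t)
  hi (item to-run            t s) = lo (item to-run t s) +ᶜ 1 m+ 0
  hi (item to-other          t s) = lo (item to-other t s)
  hi (item to-other-wrapping t s) = lo (item to-other-wrapping t s)

  kindOk : Kind → ℕ → Side → Bool
  kindOk from-run          t s = 1 m+ 0 ≤ᶜ point s (pairAt t)
  kindOk to-run            t s = point s (pairAt t) ≤ᶜ vv
  kindOk to-other          t s = point s (pairAt t) ≤ᶜ point (other s) (pairAt t)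
  kindOk to-other-wrapping t s = point s (pairAt t) ≤ᶜ point (other s) (pairAt t) +ᶜ 1+ᶜ vv

  itemOk : Item → Bool
  itemOk (item k t s) = (t ≤ᵇ cc) ∧ kindOk k t s

  coversFrom : Affine → List Item → Bool
  coversFrom s []       = half <ᶜ s
  coversFrom s (i ∷ is) = itemOk i ∧ (lo i ≤ᶜ s) ∧ coversFrom (1+ᶜ hi i) is

  record Valid : Set where
    field
      1+m≤a     : T (allBelow c (λ t → 1 m+ 1 ≤ᶜ aᶜ t))
      1+m≤b     : T (allBelow c (λ t → 1 m+ 1 ≤ᶜ bᶜ t))
      a≢b       : T (allBelow c (λ t → aᶜ t ≢ᶜ bᶜ t))
      a≤vv      : T (allBelow c (λ t → aᶜ t ≤ᶜ vv))
      b≤vv      : T (allBelow c (λ t → bᶜ t ≤ᶜ vv))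
      a≢next-a  : T (allBelow cc (λ t → aᶜ t ≢ᶜ aᶜ (suc t)))
      a≢next-b  : T (allBelow cc (λ t → aᶜ t ≢ᶜ bᶜ (suc t)))
      b≢next-a  : T (allBelow cc (λ t → bᶜ t ≢ᶜ aᶜ (suc t)))
      b≢next-b  : T (allBelow cc (λ t → bᶜ t ≢ᶜ bᶜ (suc t)))
      last-a<vv : T (aᶜ cc <ᶜ vv)
      last-b<vv : T (bᶜ cc <ᶜ vv)
      1+last-a≢a₀ : T (1+ᶜ aᶜ cc ≢ᶜ a₀)
      1+last-b≢a₀ : T (1+ᶜ bᶜ cc ≢ᶜ a₀)
      covered   : T (coversFrom (0 m+ 1) items)

module Realisation (K : Construction) (valid : Checks.Valid K) (m : ℕ) where
  open Construction K
  open Checks K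
  open Checks.Valid valid

  ⟦_⟧ₘ : Affine → ℕ
  ⟦ p ⟧ₘ = ⟦ p ⟧ m

  everywhere : ∀ {n f} → T (allBelow n f) → ∀ t → t < n → T (f t)
  everywhere {n} {f} = allBelow-sound n f

  baseBlocks : BaseBlocks ⟦ vv ⟧ₘ m cc
  baseBlocks = record
    { a           = ⟦_⟧ₘ ∘ aᶜ
    ; b           = ⟦_⟧ₘ ∘ bᶜ
    ; m<a         = λ t t≤cc →
        subst (_≤ ⟦ aᶜ t ⟧ₘ) (⟦1m+1⟧ m) (≤ᶜ-sound m (1 m+ 1) (aᶜ t) (everywhere 1+m≤a t (s≤s t≤cc)))
    ; m<b         = λ t t≤cc →
        subst (_≤ ⟦ bᶜ t ⟧ₘ) (⟦1m+1⟧ m) (≤ᶜ-sound m (1 m+ 1) (bᶜ t) (everywhere 1+m≤b t (s≤s t≤cc)))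
    ; a≢b         = λ t t≤cc → ≢ᶜ-sound m (aᶜ t) (bᶜ t) (everywhere a≢b t (s≤s t≤cc))
    ; a≤vv        = λ t t≤cc → ≤ᶜ-sound m (aᶜ t) vv (everywhere a≤vv t (s≤s t≤cc))
    ; b≤vv        = λ t t≤cc → ≤ᶜ-sound m (bᶜ t) vv (everywhere b≤vv t (s≤s t≤cc))
    ; b₀≡1+m      = ⟦1m+1⟧ m
    ; step-apart  = λ t t<cc →
        ≢ᶜ-sound m (aᶜ t) (aᶜ (suc t)) (everywhere a≢next-a t t<cc) ,
        ≢ᶜ-sound m (aᶜ t) (bᶜ (suc t)) (everywhere a≢next-b t t<cc) ,
        ≢ᶜ-sound m (bᶜ t) (aᶜ (suc t)) (everywhere b≢next-a t t<cc) ,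
        ≢ᶜ-sound m (bᶜ t) (bᶜ (suc t)) (everywhere b≢next-b t t<cc)
    ; last-a<vv   = <ᶜ-sound m (aᶜ cc) vv last-a<vv
    ; last-b<vv   = <ᶜ-sound m (bᶜ cc) vv last-b<vv
    ; 1+last-a≢a₀ = ≢ᶜ-sound m (1+ᶜ aᶜ cc) a₀ 1+last-a≢a₀ ∘ trans (⟦1+ᶜ⟧ m (aᶜ cc))
    ; 1+last-b≢a₀ = ≢ᶜ-sound m (1+ᶜ bᶜ cc) a₀ 1+last-b≢a₀ ∘ trans (⟦1+ᶜ⟧ m (bᶜ cc))
    }

  open Development baseBlocks hiding (c)

  pointₘ : Side → ℕ → ℕ
  pointₘ s t = ⟦ point s (pairAt t) ⟧ₘ

  pointₘ∈ : ∀ s t → Member t (pointₘ s t)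
  pointₘ∈ side-a t = a∈ t
  pointₘ∈ side-b t = b∈ t

  pointₘ<V : ∀ s t → t ≤ cc → pointₘ s t < V
  pointₘ<V side-a = a<V
  pointₘ<V side-b = b<V

  item-sound : ∀ i → T (itemOk i) → ∀ d → ⟦ lo i ⟧ₘ ≤ d → d ≤ ⟦ hi i ⟧ₘ → Difference d
  item-sound (item k t s) ok d with to T-∧ ok
  ... | t≤ᵇcc , kind-ok = by-kind k kind-ok
    where
    P Q : Affine
    P = point s (pairAt t)
    Q = point (other s) (pairAt t)
    p q : ℕ
    p = ⟦ P ⟧ₘ
    q = ⟦ Q ⟧ₘ
    t≤cc : t ≤ cc
    t≤cc = ≤ᵇ⇒≤ t cc t≤ᵇcc
    open ≤-Reasoning
    by-kind : ∀ k → T (kindOk k t s) → ⟦ lo (item k t s) ⟧ₘ ≤ d → d ≤ ⟦ hi (item k t s) ⟧ₘ →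
              Difference d
    by-kind from-run 1≤P lo≤d d≤p =
      difference-below t≤cc (pointₘ∈ s t) (pointₘ<V s t t≤cc) d≤p (begin
        p                   ≡⟨ ⟦∸ᶜ⟧ m P (1 m+ 0) 1≤P ⟨
        ⟦ L₀ ⟧ₘ + ⟦ 1 m+ 0 ⟧ₘ ≡⟨ cong (⟦ L₀ ⟧ₘ +_) (⟦1m+0⟧ m) ⟩
        ⟦ L₀ ⟧ₘ + m         ≤⟨ +-monoˡ-≤ m lo≤d ⟩
        d + m               ∎)
      where
      L₀ : Affine
      L₀ = P ∸ᶜ 1 m+ 0
    by-kind to-run P≤vv lo≤d d≤hi =
      difference-above t≤cc (pointₘ∈ s t) (pointₘ<V s t t≤cc)
        (begin
          V            ≡⟨ lo+p≡V ⟨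
          ⟦ L₀ ⟧ₘ + p  ≤⟨ +-monoˡ-≤ p lo≤d ⟩
          d + p        ∎)
        (begin
          d + p                   ≤⟨ +-monoˡ-≤ p d≤hi ⟩
          ⟦ L₀ +ᶜ 1 m+ 0 ⟧ₘ + p   ≡⟨ cong (_+ p) (trans (⟦+ᶜ⟧ m L₀ (1 m+ 0)) (cong (⟦ L₀ ⟧ₘ +_) (⟦1m+0⟧ m))) ⟩
          ⟦ L₀ ⟧ₘ + m + p         ≡⟨ +-assoc ⟦ L₀ ⟧ₘ m p ⟩
          ⟦ L₀ ⟧ₘ + (m + p)       ≡⟨ cong (⟦ L₀ ⟧ₘ +_) (+-comm m p) ⟩
          ⟦ L₀ ⟧ₘ + (p + m)       ≡⟨ +-assoc ⟦ L₀ ⟧ₘ p m ⟨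
          ⟦ L₀ ⟧ₘ + p + m         ≡⟨ cong (_+ m) lo+p≡V ⟩
          V + m                   ∎)
      where
      L₀ : Affine
      L₀ = 1+ᶜ (vv ∸ᶜ P)
      lo+p≡V : ⟦ L₀ ⟧ₘ + p ≡ V
      lo+p≡V = trans (cong (_+ p) (⟦1+ᶜ⟧ m (vv ∸ᶜ P))) (cong suc (⟦∸ᶜ⟧ m vv P P≤vv))
    by-kind to-other P≤Q lo≤d d≤lo =
      difference t≤cc (pointₘ∈ s t) (pointₘ∈ (other s) t) (pointₘ<V s t t≤cc) (pointₘ<V (other s) t t≤cc)
        (inj₁ (trans (cong (p +_) (sym (≤-antisym lo≤d d≤lo)))
              (trans (+-comm p _) (⟦∸ᶜ⟧ m Q P P≤Q))))
    by-kind to-other-wrapping P≤Q+V lo≤d d≤lo =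
      difference t≤cc (pointₘ∈ s t) (pointₘ∈ (other s) t) (pointₘ<V s t t≤cc) (pointₘ<V (other s) t t≤cc)
        (inj₂ (trans (cong (p +_) (sym (≤-antisym lo≤d d≤lo)))
              (trans (+-comm p _) (trans (⟦∸ᶜ⟧ m (Q +ᶜ 1+ᶜ vv) P P≤Q+V)
              (trans (⟦+ᶜ⟧ m Q (1+ᶜ vv)) (cong (q +_) (⟦1+ᶜ⟧ m vv)))))))

  coversFrom-sound : ∀ s is → T (coversFrom s is) →
                     ∀ d → ⟦ s ⟧ₘ ≤ d → d ≤ ⟦ half ⟧ₘ → Difference d
  coversFrom-sound s []       half<s d s≤d d≤half =
    ⊥-elim (<⇒≱ (<ᶜ-sound m half s half<s) (≤-trans s≤d d≤half))
  coversFrom-sound s (i ∷ is) ok     d s≤d d≤half with to T-∧ ok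
  ... | i-ok , ok′ with to T-∧ ok′
  ... | lo≤s , rest with d ≤? ⟦ hi i ⟧ₘ
  ...   | yes d≤hi = item-sound i i-ok d (≤-trans (≤ᶜ-sound m (lo i) s lo≤s) s≤d) d≤hi
  ...   | no  d≰hi =
    coversFrom-sound (1+ᶜ hi i) is rest d (subst (_≤ d) (sym (⟦1+ᶜ⟧ m (hi i))) (≰⇒> d≰hi)) d≤half

  cdccd : CDCCD (c * (2 * (2 * m + 3)) + 1) (3 + m) ((c * (2 * (2 * m + 3)) + 1) * c)
  cdccd = subst (λ V → CDCCD V (3 + m) (V * c)) V≡
    (design (differences-from-half ⟦ half ⟧ₘ (cong suc (⟦+ᶜ⟧ m half half))
                                   (coversFrom-sound (0 m+ 1) items covered)))
    where
    V≡ : V ≡ c * (2 * (2 * m + 3)) + 1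
    V≡ = trans (cong suc (⟦+ᶜ⟧ m half half)) (eq c m)
      where
      eq : ∀ c m → suc ((2 * c * m + 3 * c) + (2 * c * m + 3 * c)) ≡ c * (2 * (2 * m + 3)) + 1
      eq = solve-∀

choose-2 : ∀ n → 2 * (n C 2) + n ≡ n * n
choose-2 zero    = refl
choose-2 (suc n) = begin
    2 * (suc n C 2) + suc n            ≡⟨ cong (λ x → 2 * x + suc n) (nCk+nC[k+1]≡[n+1]C[k+1] n 1) ⟨
    2 * (n C 1 + n C 2) + suc n        ≡⟨ cong (λ x → 2 * (x + n C 2) + suc n) (nC1≡n n) ⟩
    2 * (n + n C 2) + suc n            ≡⟨ regroup n (n C 2) ⟩
    (2 * (n C 2) + n) + (2 * n + 1)    ≡⟨ cong (_+ (2 * n + 1)) (choose-2 n) ⟩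
    n * n + (2 * n + 1)                ≡⟨ square-suc n ⟩
    suc n * suc n                      ∎
  where
  open ≡-Reasoning
  regroup : ∀ n x → 2 * (n + x) + suc n ≡ (2 * x + n) + (2 * n + 1)
  regroup = solve-∀
  square-suc : ∀ n → n * n + (2 * n + 1) ≡ suc n * suc n
  square-suc = solve-∀

odd-choose-2 : ∀ x → (2 * x + 1) C 2 ≡ (2 * x + 1) * x
odd-choose-2 x = *-cancelˡ-≡ _ _ 2 (+-cancelʳ-≡ n (2 * (n C 2)) (2 * (n * x)) (trans (choose-2 n) (square n x)))
  where
  n = 2 * x + 1
  square : ∀ n x → (2 * x + 1) * (2 * x + 1) ≡ 2 * ((2 * x + 1) * x) + (2 * x + 1)
  square = solve-∀

ceilDiv-exact : ∀ b D → 0 < D → ceilDiv (b * D) D ≡ b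
ceilDiv-exact b (suc d) _ = begin
    (b * suc d + d) / suc d        ≡⟨ +-distrib-/ (b * suc d) d no-carry ⟩
    b * suc d / suc d + d / suc d  ≡⟨ cong₂ _+_ (m*n/n≡m b (suc d)) (m<n⇒m/n≡0 (n<1+n d)) ⟩
    b + 0                          ≡⟨ +-identityʳ b ⟩
    b                              ∎
  where
  open ≡-Reasoning
  no-carry : b * suc d % suc d + d % suc d < suc d
  no-carry = subst (_< suc d) (sym (cong₂ _+_ (m*n%n≡0 b (suc d)) (m<n⇒m%n≡m (n<1+n d)))) (n<1+n d)

exact⇒tight : ∀ {v k b} → 0 < 2 * k ∸ 3 → v C 2 ≡ b * (2 * k ∸ 3) → Tight v k b
exact⇒tight {v} {k} {b} 0<D C≡bD =
  sym (trans (cong (λ n → ceilDiv n (2 * k ∸ 3)) C≡bD) (ceilDiv-exact b (2 * k ∸ 3) 0<D)) ,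
  divides b C≡bD

tight-cdccd : ∀ c m → CDCCD (c * (2 * (2 * m + 3)) + 1) (3 + m) ((c * (2 * (2 * m + 3)) + 1) * c) →
              TightCDCCDExists (c * (4 * (3 + m) ∸ 6) + 1) (3 + m) (c * c * (4 * (3 + m) ∸ 6) + c)
tight-cdccd c m design = subst₂ (λ v b → TightCDCCDExists v (3 + m) b) v≡ b≡ (design , tight)
  where
  D V : ℕ
  D = 2 * m + 3
  V = c * (2 * D) + 1
  4k∸6≡2D : 4 * (3 + m) ∸ 6 ≡ 2 * D
  4k∸6≡2D = trans (cong (_∸ 6) (eq m)) (m+n∸m≡n 6 (2 * D))
    where
    eq : ∀ m → 4 * (3 + m) ≡ 6 + 2 * (2 * m + 3)
    eq = solve-∀
  2k∸3≡D : 2 * (3 + m) ∸ 3 ≡ D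
  2k∸3≡D = trans (cong (_∸ 3) (eq m)) (m+n∸m≡n 3 D)
    where
    eq : ∀ m → 2 * (3 + m) ≡ 3 + (2 * m + 3)
    eq = solve-∀
  v≡ : V ≡ c * (4 * (3 + m) ∸ 6) + 1
  v≡ = cong (λ x → c * x + 1) (sym 4k∸6≡2D)
  b≡ : V * c ≡ c * c * (4 * (3 + m) ∸ 6) + c
  b≡ = trans (eq c D) (cong (λ x → c * c * x + c) (sym 4k∸6≡2D))
    where
    eq : ∀ c D → (c * (2 * D) + 1) * c ≡ c * c * (2 * D) + c
    eq = solve-∀
  tight : Tight V (3 + m) (V * c)
  tight = exact⇒tight {V} {3 + m} (subst (0 <_) (sym 2k∸3≡D) (<-≤-trans z<s (m≤n+m 3 (2 * m)))) (begin
      V C 2                        ≡⟨ cong (_C 2) (V≡odd c D) ⟩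
      (2 * (c * D) + 1) C 2        ≡⟨ odd-choose-2 (c * D) ⟩
      (2 * (c * D) + 1) * (c * D)  ≡⟨ cong (_* (c * D)) (V≡odd c D) ⟨
      V * (c * D)                  ≡⟨ *-assoc V c D ⟨
      V * c * D                    ≡⟨ cong (V * c *_) 2k∸3≡D ⟨
      V * c * (2 * (3 + m) ∸ 3)    ∎)
    where
    open ≡-Reasoning
    V≡odd : ∀ c D → c * (2 * D) + 1 ≡ 2 * (c * D) + 1
    V≡odd = solve-∀

construction₁ construction₂ construction₃ construction₄ construction₅ : Construction
construction₁ = record
  { a₀    = 2 m+ 3
  ; pairs = []
  ; items = item from-run 0 side-b ∷ item to-other 0 side-b ∷ item from-run 0 side-a ∷ []
  }
construction₂ = record
  { a₀    = 3 m+ 4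
  ; pairs = (2 m+ 2 , 5 m+ 7) ∷ []
  ; items = item from-run 0 side-b ∷ item from-run 1 side-a ∷ item to-other 0 side-b ∷ item from-run 0 side-a
          ∷ item to-other 1 side-a ∷ item to-run 1 side-b ∷ []
  }
construction₃ = record
  { a₀    = 3 m+ 4
  ; pairs = (4 m+ 5 , 8 m+ 11) ∷ (2 m+ 2 , 6 m+ 9) ∷ []
  ; items = item from-run 0 side-b ∷ item from-run 2 side-a ∷ item to-other 0 side-b ∷ item from-run 0 side-a
          ∷ item from-run 1 side-a ∷ item to-other 1 side-a ∷ item to-other 2 side-a ∷ item to-run 1 side-b
          ∷ item from-run 2 side-b ∷ []
  }
construction₄ = record
  { a₀    = 2 m+ 3
  ; pairs = (5 m+ 7 , 11 m+ 17) ∷ (4 m+ 6 , 7 m+ 11) ∷ (3 m+ 4 , 9 m+ 13) ∷ []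
  ; items = item from-run 0 side-b ∷ item to-other 0 side-b ∷ item from-run 0 side-a ∷ item from-run 3 side-a
          ∷ item to-other 2 side-a ∷ item from-run 2 side-a ∷ item from-run 1 side-a ∷ item to-run 1 side-b
          ∷ item to-other 3 side-a ∷ item to-other 1 side-a ∷ item from-run 2 side-b ∷ item to-run 3 side-b ∷ []
  }
construction₅ = record
  { a₀    = 2 m+ 3
  ; pairs = (7 m+ 11 , 12 m+ 18) ∷ (5 m+ 6 , 11 m+ 16) ∷ (4 m+ 5 , 15 m+ 22) ∷ (3 m+ 4 , 8 m+ 12) ∷ []
  ; items = item from-run 0 side-b ∷ item to-other 0 side-b ∷ item from-run 0 side-a ∷ item from-run 4 side-a
          ∷ item from-run 3 side-a ∷ item from-run 2 side-a ∷ item to-other 1 side-a ∷ item to-other 4 side-a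
          ∷ item to-run 3 side-b ∷ item to-other 2 side-a ∷ item from-run 1 side-a ∷ item from-run 4 side-b
          ∷ item to-run 1 side-b ∷ item to-other-wrapping 3 side-b ∷ item to-run 2 side-b ∷ []
  }

valid-construction : ∀ c → 1 ≤ c → c ≤ 5 → Σ Construction (λ K → Checks.c K ≡ c × Checks.Valid K)
valid-construction 1 _ _ = construction₁ , refl , _
valid-construction 2 _ _ = construction₂ , refl , _
valid-construction 3 _ _ = construction₃ , refl , _
valid-construction 4 _ _ = construction₄ , refl , _
valid-construction 5 _ _ = construction₅ , refl , _
valid-construction (suc (suc (suc (suc (suc (suc _)))))) _ (s≤s (s≤s (s≤s (s≤s (s≤s ())))))

mainTheorem5 : ∀ (k c : ℕ) → 3 ≤ k → 1 ≤ c → c ≤ 5 →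
    TightCDCCDExists (c * (4 * k ∸ 6) + 1) k (c * c * (4 * k ∸ 6) + c)
mainTheorem5 (suc (suc (suc m))) c _ 1≤c c≤5 with valid-construction c 1≤c c≤5
... | construction , refl , valid = tight-cdccd (Checks.c construction) m (Realisation.cdccd construction valid m)
mainTheorem5 1 _ (s≤s ()) _ _
mainTheorem5 2 _ (s≤s (s≤s ())) _ _
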